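{- For every squarefree composite positive integer $N$, the set $\mathbb{Q}\text{ - }\mathcal{KS}(N)$ is finite; i.e. there are only finitely many $N$-Korselt rational bases.
   Context: For a positive integer $N\ge 2$, the $\mathbb{Q}$-Korselt set $\mathbb{Q}\text{ - }\mathcal{KS}(N)$ is the set of all rationals $\alpha=\frac{\alpha_1}{\alpha_2}\in\mathbb{Q}\setminus\{0,N\}$ (written with $\alpha_1\in\mathbb{Z}$, $\alpha_2>0$, $\gcd(\alpha_1,\alpha_2)=1$) such that the integer $\alpha_2p-\alpha_1$ divides the integer $\alpha_2N-\alpha_1$ for every prime divisor $p$ of $N$. Its elements are called $N$-Korselt rational bases. -}

module Defs where

open import Data.Nat as ℕ using (ℕ)
open import Data.Nat.Primality using (Prime)
open import Data.Integer as ℤ using (ℤ; +_)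
open import Data.Integer.Divisibility as ℤD
open import Data.Rational as ℚ using (ℚ; ↥_; ↧_; 0ℚ)
open import Data.List using (List)
open import Data.List.Membership.Propositional using (_∈_)
open import Relation.Binary.PropositionalEquality using (_≡_; _≢_)
open import Data.Product using (∃)

SquareFree : ℕ → Set
SquareFree N = ∀ p → Prime p → Data.Nat.Divisibility._∣_ (p ℕ.* p) N → Data.Empty.⊥
  where import Data.Nat.Divisibility
        import Data.Empty

IsKorseltBase : ℕ → ℚ → Set
IsKorseltBase N α =
  (α ≢ 0ℚ) Data.Product.× (α ≢ (+ N) ℚ./ 1) Data.Product.×
  (∀ p → Prime p → Data.Nat.Divisibility._∣_ p N →
     ((↧ α) ℤ.* (+ p) ℤ.- (↥ α)) ℤD.∣ ((↧ α) ℤ.* (+ N) ℤ.- (↥ α)))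
  where import Data.Nat.Divisibility
        import Data.Product

KorseltSetFinite : ℕ → Set
KorseltSetFinite N = ∃ λ (xs : List ℚ) → ∀ α → IsKorseltBase N α → α ∈ xs

{-# OPTIONS --safe #-}
-- For α = a/b in lowest terms and a prime p ∣ N, the Korselt divisor b p − a is coprime to b
-- and divides (b N − a) − (b p − a) = b (N − p), hence divides N − p; so |b p − a| ≤ N.
-- Two distinct primes p, q ∣ N (which exist as N is squarefree and composite) then bound
-- b ≤ |b (q − p)| = |(b q − a) − (b p − a)| ≤ 2N, and a = b p − (b p − a) is bounded too:
-- α ranges over a finite box of numerators and denominators.
module Submission where

open import Defs
open import Data.Nat using (ℕ)
open import Data.Nat.Primality using (Composite)

open import Data.Nat as ℕ using (suc; _≤_; _<_; NonZero; s≤s)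
import Data.Nat.Properties as ℕ
import Data.Nat.Divisibility as ℕ
import Data.Nat.Coprimality as ℕC
open import Data.Nat.Primality using (Prime; composite⇒¬prime; composite⇒nonZero; ¬composite[1])
open import Data.Nat.Primality.Factorisation using (factorise)
open import Data.Nat.ListAction using (product)
open import Data.Integer as ℤ using (ℤ; +_; -[1+_]; ∣_∣; _*_; _-_)
import Data.Integer.Properties as ℤ
open import Data.Integer.Divisibility using (_∣_)
import Data.Integer.Divisibility.Signed as ℤS
open import Data.Integer.Coprimality using (Coprime; coprime-divisor)
open import Data.Integer.Tactic.RingSolver using (solve-∀)
open import Data.Rational as ℚ using (ℚ; ↥_; ↧_; ↧ₙ_; _/_)
open import Data.Rational.Properties using (↥p/↧p≡p)
open import Data.List using (List; []; _∷_; _++_; map; upTo; cartesianProductWith)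
open import Data.List.Relation.Unary.All using (_∷_)
open import Data.List.Membership.Propositional using (_∈_)
open import Data.List.Membership.Propositional.Properties
  using (∈-map⁺; ∈-++⁺ˡ; ∈-++⁺ʳ; ∈-upTo⁺; ∈-cartesianProductWith⁺)
open import Data.Product using (∃₂; _,_; _×_; uncurry)
open import Data.Sum using (inj₁; inj₂)
open import Data.Empty using (⊥-elim)
open import Relation.Nullary.Decidable using (recompute)
open import Function using (_∘_)
open import Relation.Binary.PropositionalEquality

integersWithin : ℕ → List ℤ
integersWithin A = map +_ (upTo (suc A)) ++ map -[1+_] (upTo A)

∈-integersWithin : ∀ {A} i → ∣ i ∣ ≤ A → i ∈ integersWithin A
∈-integersWithin (+ n)    n≤A = ∈-++⁺ˡ (∈-map⁺ +_ (∈-upTo⁺ (s≤s n≤A)))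
∈-integersWithin -[1+ n ] n<A = ∈-++⁺ʳ _ (∈-map⁺ -[1+_] (∈-upTo⁺ n<A))

rationalsWithin : ℕ → ℕ → List ℚ
rationalsWithin A D =
  cartesianProductWith (λ n d-1 → n / suc d-1) (integersWithin A) (upTo D)

∈-rationalsWithin : ∀ {A D} α → ∣ ↥ α ∣ ≤ A → ↧ₙ α ≤ D → α ∈ rationalsWithin A D
∈-rationalsWithin α n≤A d≤D = subst (_∈ _) (↥p/↧p≡p α)
  (∈-cartesianProductWith⁺ _ (∈-integersWithin (↥ α) n≤A) (∈-upTo⁺ d≤D))

↥-↧-coprime : ∀ α → Coprime (↥ α) (↧ α)
↥-↧-coprime (ℚ.mkℚ _ _ n⊥d) = recompute (ℕC.coprime? _ _) n⊥d

a≡b*c-[b*c-a] : ∀ a b c → a ≡ b * c - (b * c - a)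
a≡b*c-[b*c-a] = solve-∀

b*c-a-coprime : ∀ a b c → Coprime a b → Coprime (b * c - a) b
b*c-a-coprime a b c a⊥b {i} (i∣b*c-a , i∣b) = a⊥b (ℤS.∣⇒∣ᵤ {+ i} {a} i∣a , i∣b)
  where
  i∣a : + i ℤS.∣ a
  i∣a = subst (+ i ℤS.∣_) (sym (a≡b*c-[b*c-a] a b c))
    (ℤS.∣m∣n⇒∣m-n {+ i} {b * c} (ℤS.∣m⇒∣m*n {+ i} {b} c (ℤS.∣ᵤ⇒∣ {+ i} {b} i∣b))
                   (ℤS.∣ᵤ⇒∣ {+ i} {b * c - a} i∣b*c-a))

[b*n-a]-[b*c-a]≡b*[n-c] : ∀ a b c n → (b * n - a) - (b * c - a) ≡ b * (n - c)
[b*n-a]-[b*c-a]≡b*[n-c] = solve-∀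

b*c-a∣b*n-a⇒∣n-c : ∀ a b c n → Coprime a b →
                   (b * c - a) ∣ (b * n - a) → (b * c - a) ∣ (n - c)
b*c-a∣b*n-a⇒∣n-c a b c n a⊥b x∣b*n-a =
  coprime-divisor x b (n - c) (b*c-a-coprime a b c a⊥b) (ℤS.∣⇒∣ᵤ {x} x∣b*[n-c])
  where
  x : ℤ
  x = b * c - a
  x∣b*[n-c] : x ℤS.∣ b * (n - c)
  x∣b*[n-c] = subst (x ℤS.∣_) ([b*n-a]-[b*c-a]≡b*[n-c] a b c n)
    (ℤS.∣m∣n⇒∣m-n {x} {b * n - a} (ℤS.∣ᵤ⇒∣ x∣b*n-a) (ℤS.∣-refl {x}))

∣b*p-a∣≤N : ∀ a b {p N} → Coprime a b → p < N →
            (b * + p - a) ∣ (b * + N - a) → ∣ b * + p - a ∣ ≤ N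
∣b*p-a∣≤N a b {p} {N} a⊥b p<N x∣b*N-a =
  ℕ.≤-trans (ℕ.∣⇒≤ {{ℕ.>-nonZero (ℕ.m<n⇒0<n∸m p<N)}} x∣N∸p) (ℕ.m∸n≤m N p)
  where
  ∣N-p∣≡N∸p : ∣ + N - + p ∣ ≡ N ℕ.∸ p
  ∣N-p∣≡N∸p = cong ∣_∣ (trans (ℤ.m-n≡m⊖n N p) (ℤ.⊖-≥ (ℕ.<⇒≤ p<N)))
  x∣N∸p : ∣ b * + p - a ∣ ℕ.∣ N ℕ.∸ p
  x∣N∸p = subst (_ ℕ.∣_) ∣N-p∣≡N∸p (b*c-a∣b*n-a⇒∣n-c a b (+ p) (+ N) a⊥b x∣b*N-a)

∣b∣≤∣b*c-a∣+∣b*d-a∣ : ∀ a b {c d} → c ≢ d → ∣ b ∣ ≤ ∣ b * c - a ∣ ℕ.+ ∣ b * d - a ∣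
∣b∣≤∣b*c-a∣+∣b*d-a∣ a b {c} {d} c≢d = begin
  ∣ b ∣                                 ≤⟨ ℕ.m≤m*n ∣ b ∣ ∣ d - c ∣ {{∣d-c∣≢0}} ⟩
  ∣ b ∣ ℕ.* ∣ d - c ∣                   ≡⟨ ℤ.abs-* b (d - c) ⟨
  ∣ b * (d - c) ∣                       ≡⟨ cong ∣_∣ ([b*n-a]-[b*c-a]≡b*[n-c] a b c d) ⟨
  ∣ (b * d - a) - (b * c - a) ∣         ≤⟨ ℤ.∣i-j∣≤∣i∣+∣j∣ (b * d - a) (b * c - a) ⟩
  ∣ b * d - a ∣ ℕ.+ ∣ b * c - a ∣       ≡⟨ ℕ.+-comm ∣ b * d - a ∣ ∣ b * c - a ∣ ⟩
  ∣ b * c - a ∣ ℕ.+ ∣ b * d - a ∣       ∎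
  where
  open ℕ.≤-Reasoning
  ∣d-c∣≢0 : NonZero ∣ d - c ∣
  ∣d-c∣≢0 = ℕ.≢-nonZero (λ ∣d-c∣≡0 → c≢d (sym (ℤ.i-j≡0⇒i≡j d c (ℤ.∣i∣≡0⇒i≡0 ∣d-c∣≡0))))

∣a∣≤∣b∣*∣c∣+∣b*c-a∣ : ∀ a b c → ∣ a ∣ ≤ ∣ b ∣ ℕ.* ∣ c ∣ ℕ.+ ∣ b * c - a ∣
∣a∣≤∣b∣*∣c∣+∣b*c-a∣ a b c = begin
  ∣ a ∣                                 ≡⟨ cong ∣_∣ (a≡b*c-[b*c-a] a b c) ⟩
  ∣ b * c - (b * c - a) ∣               ≤⟨ ℤ.∣i-j∣≤∣i∣+∣j∣ (b * c) (b * c - a) ⟩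
  ∣ b * c ∣ ℕ.+ ∣ b * c - a ∣           ≡⟨ cong (ℕ._+ ∣ b * c - a ∣) (ℤ.abs-* b c) ⟩
  ∣ b ∣ ℕ.* ∣ c ∣ ℕ.+ ∣ b * c - a ∣     ∎
  where open ℕ.≤-Reasoning

prime∣composite⇒< : ∀ {n p} → Composite n → Prime p → p ℕ.∣ n → p < n
prime∣composite⇒< c p-prime p∣n with ℕ.m≤n⇒m<n∨m≡n (ℕ.∣⇒≤ {{composite⇒nonZero c}} p∣n)
... | inj₁ p<n  = p<n
... | inj₂ refl = ⊥-elim (composite⇒¬prime c p-prime)

distinct-prime-divisors : ∀ {n} → SquareFree n → Composite n →
  ∃₂ λ p q → p ≢ q × Prime p × Prime q × p ℕ.∣ n × q ℕ.∣ n
distinct-prime-divisors {n} sf c with factorise n {{composite⇒nonZero c}}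
... | record { factors = [] ; isFactorisation = n≡1 } =
  ⊥-elim (¬composite[1] (subst Composite n≡1 c))
... | record { factors = p ∷ [] ; isFactorisation = n≡p*1 ; factorsPrime = p-prime ∷ _ } =
  ⊥-elim (composite⇒¬prime c (subst Prime (sym (trans n≡p*1 (ℕ.*-identityʳ p))) p-prime))
... | record { factors = p ∷ q ∷ rs ; isFactorisation = n≡p*[q*r]
             ; factorsPrime = p-prime ∷ q-prime ∷ _ } =
  p , q , p≢q , p-prime , q-prime , divides-n (ℕ.m∣m*n _) , divides-n (ℕ.∣n⇒∣m*n p (ℕ.m∣m*n _))
  where
  divides-n : ∀ {d} → d ℕ.∣ p ℕ.* (q ℕ.* product rs) → d ℕ.∣ n
  divides-n = subst (_ ℕ.∣_) (sym n≡p*[q*r])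
  p≢q : p ≢ q
  p≢q refl = sf p p-prime (divides-n (ℕ.*-monoʳ-∣ p (ℕ.m∣m*n _)))

korselt-base-bounds : ∀ {N p q} α → p ≢ q → p < N → q < N →
  (↧ α * + p - ↥ α) ∣ (↧ α * + N - ↥ α) → (↧ α * + q - ↥ α) ∣ (↧ α * + N - ↥ α) →
  ∣ ↥ α ∣ ≤ (N ℕ.+ N) ℕ.* N ℕ.+ N × ↧ₙ α ≤ N ℕ.+ N
korselt-base-bounds {N} {p} {q} α p≢q p<N q<N p-korselt q-korselt = ∣a∣≤[N+N]*N+N , b≤N+N
  where
  a : ℤ
  a = ↥ α
  b : ℤ
  b = ↧ α
  p-bound : ∣ b * + p - a ∣ ≤ N
  p-bound = ∣b*p-a∣≤N a b (↥-↧-coprime α) p<N p-korselt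
  q-bound : ∣ b * + q - a ∣ ≤ N
  q-bound = ∣b*p-a∣≤N a b (↥-↧-coprime α) q<N q-korselt
  b≤N+N : ↧ₙ α ≤ N ℕ.+ N
  b≤N+N = ℕ.≤-trans (∣b∣≤∣b*c-a∣+∣b*d-a∣ a b (p≢q ∘ ℤ.+-injective))
                    (ℕ.+-mono-≤ p-bound q-bound)
  ∣a∣≤[N+N]*N+N : ∣ a ∣ ≤ (N ℕ.+ N) ℕ.* N ℕ.+ N
  ∣a∣≤[N+N]*N+N = ℕ.≤-trans (∣a∣≤∣b∣*∣c∣+∣b*c-a∣ a b (+ p))
                            (ℕ.+-mono-≤ (ℕ.*-mono-≤ b≤N+N (ℕ.<⇒≤ p<N)) p-bound)

theorem2p2 : (N : ℕ) → SquareFree N → Composite N → KorseltSetFinite N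
theorem2p2 N sf c with distinct-prime-divisors sf c
... | p , q , p≢q , p-prime , q-prime , p∣N , q∣N =
  rationalsWithin ((N ℕ.+ N) ℕ.* N ℕ.+ N) (N ℕ.+ N) , λ α (_ , _ , korselt) →
    uncurry (∈-rationalsWithin α)
      (korselt-base-bounds α p≢q (prime∣composite⇒< c p-prime p∣N) (prime∣composite⇒< c q-prime q∣N)
                           (korselt p p-prime p∣N) (korselt q q-prime q∣N))
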